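{- Let $k \ge 3$ and let $0 \le v < \lvert I_{k-2}\rvert$ be an integer. Then $$\deg(B_{c_k+v}) = \deg(B_{2^{k-2}-(a_{k-2}+v)})+1 \quad\text{and}\quad \ell c(B_{c_k+v}) = \ell c(B_{2^{k-2}-(a_{k-2}+v)})+\ell c(B_{a_{k-2}+v}).$$
   Context: The Stern polynomials $B_n(t)\in\mathbb{Z}[t]$ are defined by $B_0=0$, $B_1=1$, $B_{2n}=tB_n$, $B_{2n+1}=B_n+B_{n+1}$; $\ell c$ denotes the leading coefficient. A BSD representation of an integer is a digit string $(b_{m-1}\cdots b_0)$ with $b_j\in\{1,0,-1\}$ representing $\sum b_j2^j$. A non-adjacent form (NAF) is a BSD representation in which no two adjacent digits are both nonzero; it is reduced if its leading digit is nonzero. Every positive integer has exactly one reduced NAF; its length is the NAF-bitlength. $I_k$ denotes the set of positive integers of NAF-bitlength $k$ (a set of consecutive integers, e.g. $I_1=\{1\},I_2=\{2\},I_3=\{3,4,5\}$), and for $k\ge3$, $\lvert I_k\rvert=2\lvert I_{k-2}\rvert+\lvert I_{k-1}\rvert$. Write $a_k=\min I_k$ for $k\ge1$ and $a_0=0$ (equivalently $a_1=1,a_2=2$, $a_k=2^{k-2}+a_{k-2}$). For $k\ge 3$, $c_k=2^{k-1}+a_{k-2}$ is the smallest element of the last $\lvert I_{k-2}\rvert$ elements of $I_k$ (the subinterval $\mathcal{C}_k$). -}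

module Defs where

open import Data.Nat using (ℕ; zero; suc; _+_; _∸_; _^_; _/_)
open import Data.Nat.Base using (_%_)
open import Data.Integer using (ℤ; 0ℤ; 1ℤ) renaming (_+_ to _+ℤ_)
open import Data.List using (List; []; _∷_; length; reverse; dropWhile)
open import Relation.Nullary.Decidable using (does)
open import Data.Integer.Properties using (_≟_)

-- Polynomials in ℤ[t] as little-endian coefficient lists (index i = coeff of t^i).
Poly : Set
Poly = List ℤ

_⊕_ : Poly → Poly → Poly
[] ⊕ q = q
(x ∷ p) ⊕ [] = x ∷ p
(x ∷ p) ⊕ (y ∷ q) = (x +ℤ y) ∷ (p ⊕ q)

tmul : Poly → Poly
tmul p = 0ℤ ∷ p

normalize : Poly → Poly
normalize p = reverse (dropWhile (λ c → c ≟ 0ℤ) (reverse p))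

-- degree (convention: deg 0 = 0) and leading coefficient (lc 0 = 0)
deg : Poly → ℕ
deg p = length (normalize p) ∸ 1

lastOr0 : List ℤ → ℤ
lastOr0 [] = 0ℤ
lastOr0 (x ∷ []) = x
lastOr0 (x ∷ y ∷ xs) = lastOr0 (y ∷ xs)

lc : Poly → ℤ
lc p = lastOr0 (normalize p)

-- Stern polynomials, with fuel (fuel > n suffices):
-- B 0 = 0, B 1 = 1, B (2n) = t B n, B (2n+1) = B n + B (n+1)
sternF : ℕ → ℕ → Poly
sternF zero n = []
sternF (suc f) zero = []
sternF (suc f) (suc zero) = 1ℤ ∷ []
sternF (suc f) (suc (suc n)) with (suc (suc n)) % 2
... | zero = tmul (sternF f ((suc (suc n)) / 2))
... | suc _ = sternF f ((suc (suc n)) / 2) ⊕ sternF f (suc ((suc (suc n)) / 2))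

B : ℕ → Poly
B n = sternF (suc n) n

-- a_k = min I_k : a_0 = 0, a_1 = 1, a_2 = 2, a_k = 2^(k-2) + a_(k-2) for k ≥ 3
a : ℕ → ℕ
a zero = 0
a (suc zero) = 1
a (suc (suc zero)) = 2
a (suc (suc (suc k))) = 2 ^ (suc k) + a (suc k)

-- |I_k| = a_(k+1) - a_k  (I_k is the interval [a_k, a_(k+1)) )
cardI : ℕ → ℕ
cardI k = a (suc k) ∸ a k

c : ℕ → ℕ
c k = 2 ^ (k ∸ 1) + a (k ∸ 2)

-- Put P = 2^(k-2), l = a_(k-2) + v ∈ I_(k-2) and m = P - l.  Two applications of
-- B_(2^n + l) = B_(2^n - l) + t B_l (for l ≤ 2^n) give
-- B_(c_k + v) = B_(2P + l) = B_l + t B_m + t B_l.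
-- Nonzero Stern polynomials have positive leading coefficients, and B_l and
-- B_(2^j - l) have the same degree for l ∈ I_j: the reflection l ↦ 2^j - l maps I_j onto
-- itself, so induction on j goes through by splitting l modulo 4 (the reflection swaps
-- the residues 1 and 3).  Hence t B_m and t B_l have the common degree deg B_m + 1,
-- which B_l does not reach, and there their leading coefficients add up.

module Submission where

open import Defs
open import Data.Nat
open import Data.Nat.Properties
open import Data.Nat.DivMod using (m*n%n≡0; m*n/n≡m; [m+kn]%n≡m%n; +-distrib-/)
open import Data.Nat.Induction using (<-rec)
open import Data.Nat.Tactic.RingSolver using (solve-∀)
open import Data.Integer using (+_; 0ℤ) renaming (_+_ to _+ℤ_)
import Data.Integer.Properties as ℤ
open import Data.List using ([]; _∷_; length; reverse; dropWhile; _∷ʳ_; _∷ʳ′_; initLast)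
open import Data.List.Properties using (reverse-++; reverse-involutive)
open import Data.Product using (∃-syntax; _×_; _,_; proj₁; proj₂)
open import Algebra.Bundles using (CommutativeSemigroup)
open import Relation.Binary.Definitions using (tri<; tri≈; tri>)
open import Relation.Binary.PropositionalEquality
open import Function using (_∘_)

-- Polynomials as coefficient lists

⊕-identityʳ : ∀ p → p ⊕ [] ≡ p
⊕-identityʳ []      = refl
⊕-identityʳ (_ ∷ _) = refl

⊕-comm : ∀ p q → p ⊕ q ≡ q ⊕ p
⊕-comm []      q       = sym (⊕-identityʳ q)
⊕-comm (_ ∷ _) []      = refl
⊕-comm (x ∷ p) (y ∷ q) = cong₂ _∷_ (ℤ.+-comm x y) (⊕-comm p q)

⊕-assoc : ∀ p q r → (p ⊕ q) ⊕ r ≡ p ⊕ (q ⊕ r)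
⊕-assoc []      q       r       = refl
⊕-assoc (_ ∷ _) []      r       = refl
⊕-assoc (_ ∷ _) (_ ∷ _) []      = refl
⊕-assoc (x ∷ p) (y ∷ q) (z ∷ r) = cong₂ _∷_ (ℤ.+-assoc x y z) (⊕-assoc p q r)

⊕-commutativeSemigroup : CommutativeSemigroup _ _
⊕-commutativeSemigroup = record
  { _≈_ = _≡_
  ; _∙_ = _⊕_
  ; isCommutativeSemigroup = record
    { isSemigroup = record
      { isMagma = record { isEquivalence = isEquivalence ; ∙-cong = cong₂ _⊕_ }
      ; assoc = ⊕-assoc
      }
    ; comm = ⊕-comm
    }
  }

open import Algebra.Properties.CommutativeSemigroup ⊕-commutativeSemigroup
  using () renaming (interchange to ⊕-interchange)

length-⊕ : ∀ p q → length (p ⊕ q) ≡ length p ⊔ length q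
length-⊕ []      q       = refl
length-⊕ (_ ∷ _) []      = refl
length-⊕ (_ ∷ p) (_ ∷ q) = cong suc (length-⊕ p q)

lastOr0-⊕-equal : ∀ p q → length p ≡ length q → lastOr0 (p ⊕ q) ≡ lastOr0 p +ℤ lastOr0 q
lastOr0-⊕-equal []          []          _  = refl
lastOr0-⊕-equal (_ ∷ [])    (_ ∷ [])    _  = refl
lastOr0-⊕-equal (_ ∷ x ∷ p) (_ ∷ y ∷ q) eq =
  lastOr0-⊕-equal (x ∷ p) (y ∷ q) (suc-injective eq)
lastOr0-⊕-equal (_ ∷ [])    (_ ∷ _ ∷ _) ()
lastOr0-⊕-equal (_ ∷ _ ∷ _) (_ ∷ [])    ()

lastOr0-⊕-longer : ∀ p q → length p < length q → lastOr0 (p ⊕ q) ≡ lastOr0 q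
lastOr0-⊕-longer []          q           _        = refl
lastOr0-⊕-longer (_ ∷ [])    (_ ∷ _ ∷ _) _        = refl
lastOr0-⊕-longer (_ ∷ x ∷ p) (_ ∷ y ∷ q) (s≤s lt) = lastOr0-⊕-longer (x ∷ p) (y ∷ q) lt
lastOr0-⊕-longer (_ ∷ [])    (_ ∷ [])    (s≤s ())
lastOr0-⊕-longer (_ ∷ _ ∷ _) (_ ∷ [])    (s≤s ())

-- Unlike tmul, t·_ keeps the zero polynomial [] in normal form.
infix 30 t·_
t·_ : Poly → Poly
t· []      = []
t· (x ∷ p) = 0ℤ ∷ x ∷ p

t·-distrib-⊕ : ∀ p q → t· (p ⊕ q) ≡ t· p ⊕ t· q
t·-distrib-⊕ []      q       = refl
t·-distrib-⊕ (_ ∷ _) []      = refl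
t·-distrib-⊕ (_ ∷ _) (_ ∷ _) = refl

lastOr0-t· : ∀ p → lastOr0 (t· p) ≡ lastOr0 p
lastOr0-t· []      = refl
lastOr0-t· (_ ∷ _) = refl

LeadingPositive : Poly → Set
LeadingPositive p = ∃[ e ] lastOr0 p ≡ + suc e

⊕-leadingPositive : ∀ p q → LeadingPositive p → LeadingPositive q → LeadingPositive (p ⊕ q)
⊕-leadingPositive p q (e , p↑) (f , q↑) with <-cmp (length p) (length q)
... | tri< lt _ _ = f , trans (lastOr0-⊕-longer p q lt) q↑
... | tri≈ _ eq _ = e + suc f , trans (lastOr0-⊕-equal p q eq) (cong₂ _+ℤ_ p↑ q↑)
... | tri> _ _ gt = e , trans (cong lastOr0 (⊕-comm p q)) (trans (lastOr0-⊕-longer q p gt) p↑)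

tmul-leadingPositive : ∀ p → LeadingPositive p → LeadingPositive (tmul p)
tmul-leadingPositive (_ ∷ _) lp = lp

t·-leadingPositive : ∀ p → LeadingPositive p → LeadingPositive (t· p)
t·-leadingPositive p (e , p↑) = e , trans (lastOr0-t· p) p↑

tmul≡t· : ∀ p → LeadingPositive p → tmul p ≡ t· p
tmul≡t· (_ ∷ _) _ = refl

length-t· : ∀ p → LeadingPositive p → length (t· p) ≡ suc (length p)
length-t· (_ ∷ _) _ = refl

leadingPositive⇒0<length : ∀ p → LeadingPositive p → 0 < length p
leadingPositive⇒0<length (_ ∷ _) _ = s≤s z≤n

lastOr0-∷ʳ : ∀ xs x → lastOr0 (xs ∷ʳ x) ≡ x
lastOr0-∷ʳ []           x = refl
lastOr0-∷ʳ (_ ∷ [])     x = refl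
lastOr0-∷ʳ (_ ∷ y ∷ xs) x = lastOr0-∷ʳ (y ∷ xs) x

normalize-∷ʳ-positive : ∀ xs e → normalize (xs ∷ʳ + suc e) ≡ xs ∷ʳ + suc e
normalize-∷ʳ-positive xs e = begin
  reverse (dropWhile (λ c → c ℤ.≟ 0ℤ) (reverse (xs ∷ʳ + suc e)))
    ≡⟨ cong (λ r → reverse (dropWhile (λ c → c ℤ.≟ 0ℤ) r)) (reverse-++ xs (+ suc e ∷ [])) ⟩
  -- dropWhile stops at once: + suc e ≟ 0ℤ computes to no.
  reverse (+ suc e ∷ reverse xs)
    ≡⟨ cong reverse (reverse-++ xs (+ suc e ∷ [])) ⟨
  reverse (reverse (xs ∷ʳ + suc e))
    ≡⟨ reverse-involutive (xs ∷ʳ + suc e) ⟩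
  xs ∷ʳ + suc e ∎
  where open ≡-Reasoning

normalize-leadingPositive : ∀ p → LeadingPositive p → normalize p ≡ p
normalize-leadingPositive p lp with initLast p
normalize-leadingPositive .[] (_ , ()) | []
normalize-leadingPositive .(xs ∷ʳ x) (e , x↑) | xs ∷ʳ′ x
  rewrite trans (sym (lastOr0-∷ʳ xs x)) x↑ = normalize-∷ʳ-positive xs e

deg-leadingPositive : ∀ p → LeadingPositive p → deg p ≡ length p ∸ 1
deg-leadingPositive p p↑ = cong (λ q → length q ∸ 1) (normalize-leadingPositive p p↑)

lc-leadingPositive : ∀ p → LeadingPositive p → lc p ≡ lastOr0 p
lc-leadingPositive p p↑ = cong lastOr0 (normalize-leadingPositive p p↑)

leading-terms : ∀ p q → LeadingPositive p → LeadingPositive q → length p ≡ length q →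
  deg ((p ⊕ t· q) ⊕ t· p) ≡ deg q + 1 × lc ((p ⊕ t· q) ⊕ t· p) ≡ lc q +ℤ lc p
leading-terms p q p↑ q↑ |p|≡|q| = deg-r , lc-r
  where
  open ≡-Reasoning
  s = p ⊕ t· q
  r = s ⊕ t· p
  |t·p| = length-t· p p↑
  |t·q| = length-t· q q↑
  |p|<|t·q| : length p < length (t· q)
  |p|<|t·q| = subst (length p <_) (trans (cong suc |p|≡|q|) (sym |t·q|)) ≤-refl
  |s| : length s ≡ suc (length p)
  |s| = begin
    length (p ⊕ t· q)              ≡⟨ length-⊕ p (t· q) ⟩
    length p ⊔ length (t· q)       ≡⟨ m≤n⇒m⊔n≡n (<⇒≤ |p|<|t·q|) ⟩
    length (t· q)                  ≡⟨ trans |t·q| (cong suc (sym |p|≡|q|)) ⟩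
    suc (length p)                 ∎
  |r| : length r ≡ suc (length p)
  |r| = trans (length-⊕ s (t· p)) (trans (cong₂ _⊔_ |s| |t·p|) (⊔-idem _))
  last-s : lastOr0 s ≡ lastOr0 q
  last-s = trans (lastOr0-⊕-longer p (t· q) |p|<|t·q|) (lastOr0-t· q)
  r↑ : LeadingPositive r
  r↑ = ⊕-leadingPositive s (t· p) (⊕-leadingPositive p (t· q) p↑ (t·-leadingPositive q q↑))
                                   (t·-leadingPositive p p↑)
  deg-r : deg r ≡ deg q + 1
  deg-r = begin
    deg r                ≡⟨ deg-leadingPositive r r↑ ⟩
    length r ∸ 1         ≡⟨ cong (_∸ 1) |r| ⟩
    length p             ≡⟨ |p|≡|q| ⟩
    length q             ≡⟨ m∸n+n≡m (leadingPositive⇒0<length q q↑) ⟨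
    length q ∸ 1 + 1     ≡⟨ cong (_+ 1) (deg-leadingPositive q q↑) ⟨
    deg q + 1            ∎
  lc-r : lc r ≡ lc q +ℤ lc p
  lc-r = begin
    lc r                          ≡⟨ lc-leadingPositive r r↑ ⟩
    lastOr0 r                     ≡⟨ lastOr0-⊕-equal s (t· p) (trans |s| (sym |t·p|)) ⟩
    lastOr0 s +ℤ lastOr0 (t· p)   ≡⟨ cong₂ _+ℤ_ last-s (lastOr0-t· p) ⟩
    lastOr0 q +ℤ lastOr0 p        ≡⟨ cong₂ _+ℤ_ (lc-leadingPositive q q↑) (lc-leadingPositive p p↑) ⟨
    lc q +ℤ lc p                  ∎

-- Arithmetic on ℕ

data EvenOrOdd : ℕ → Set where
  even : ∀ x → EvenOrOdd (2 * x)
  odd  : ∀ x → EvenOrOdd (suc (2 * x))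

evenOrOdd : ∀ n → EvenOrOdd n
evenOrOdd zero = even 0
evenOrOdd (suc n) with evenOrOdd n
... | even x = odd x
... | odd x  = subst EvenOrOdd (*-suc 2 x) (even (suc x))

data Residue4 : ℕ → Set where
  even : ∀ x → Residue4 (2 * x)
  1+4k : ∀ k → Residue4 (suc (2 * (2 * k)))
  3+4k : ∀ k → Residue4 (suc (2 * suc (2 * k)))

residue4 : ∀ n → Residue4 n
residue4 n with evenOrOdd n
... | even x = even x
... | odd x with evenOrOdd x
...   | even k = 1+4k k
...   | odd k  = 3+4k k

1+x<2[1+x] : ∀ x → suc x < 2 * suc x
1+x<2[1+x] x = m<m+n (suc x) (s≤s z≤n)

2≤2[1+x] : ∀ x → 2 ≤ 2 * suc x
2≤2[1+x] x = ≤-trans (s≤s (s≤s z≤n)) (1+x<2[1+x] x)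

2x%2≡0 : ∀ x → 2 * x % 2 ≡ 0
2x%2≡0 x = trans (cong (_% 2) (*-comm 2 x)) (m*n%n≡0 x 2)

2x/2≡x : ∀ x → 2 * x / 2 ≡ x
2x/2≡x x = trans (cong (_/ 2) (*-comm 2 x)) (m*n/n≡m x 2)

[1+2x]%2≡1 : ∀ x → suc (2 * x) % 2 ≡ 1
[1+2x]%2≡1 x = trans (cong (λ y → suc y % 2) (*-comm 2 x)) ([m+kn]%n≡m%n 1 x 2)

[1+2x]/2≡x : ∀ x → suc (2 * x) / 2 ≡ x
[1+2x]/2≡x x =
  trans (+-distrib-/ 1 (2 * x) (subst (λ r → 1 + r < 2) (sym (2x%2≡0 x)) ≤-refl)) (2x/2≡x x)

m+n≡o⇒o∸n≡m : ∀ {m n o} → m + n ≡ o → o ∸ n ≡ m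
m+n≡o⇒o∸n≡m {m} {n} refl = m+n∸n≡m m n

1+[m∸[1+n]]≡m∸n : ∀ {m n} → suc n ≤ m → suc (m ∸ suc n) ≡ m ∸ n
1+[m∸[1+n]]≡m∸n {suc m} {zero}  _         = refl
1+[m∸[1+n]]≡m∸n {suc m} {suc n} (s≤s n<m) = 1+[m∸[1+n]]≡m∸n n<m

v<n∸m⇒m+v<n : ∀ m {n v} → v < n ∸ m → m + v < n
v<n∸m⇒m+v<n m {n} {v} v<n∸m = subst (m + v <_) (m+[n∸m]≡n m≤n) (+-monoʳ-< m v<n∸m)
  where
  m≤n : m ≤ n
  m≤n = <⇒≤ (m∸n≢0⇒n<m (λ n∸m≡0 → n≮0 (subst (v <_) n∸m≡0 v<n∸m)))

c*y≤c*x+r⇒y≤x : ∀ c {x y r} → r < c → c * y ≤ c * x + r → y ≤ x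
c*y≤c*x+r⇒y≤x c {x} {y} {r} r<c cy≤cx+r = ≤-pred (*-cancelˡ-< c y (suc x) (begin-strict
  c * y       ≤⟨ cy≤cx+r ⟩
  c * x + r   <⟨ +-monoʳ-< (c * x) r<c ⟩
  c * x + c   ≡⟨ +-comm (c * x) c ⟩
  c + c * x   ≡⟨ *-suc c x ⟨
  c * suc x   ∎))
  where open ≤-Reasoning

2P∸[1+2m] : ∀ P m → suc m ≤ P → 2 * P ∸ suc (2 * m) ≡ suc (2 * (P ∸ suc m))
2P∸[1+2m] P m 1+m≤P = m+n≡o⇒o∸n≡m (begin
  suc (2 * (P ∸ suc m)) + suc (2 * m) ≡⟨ identity (P ∸ suc m) m ⟩
  2 * (P ∸ suc m + suc m)             ≡⟨ cong (2 *_) (m∸n+n≡m 1+m≤P) ⟩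
  2 * P                               ∎)
  where
  open ≡-Reasoning
  identity : ∀ q m → suc (2 * q) + suc (2 * m) ≡ 2 * (q + suc m)
  identity = solve-∀

4T∸[1+4y] : ∀ T y → suc y ≤ T → 2 * (2 * T) ∸ suc (2 * (2 * y)) ≡ suc (2 * suc (2 * (T ∸ suc y)))
4T∸[1+4y] T y 1+y≤T =
  m+n≡o⇒o∸n≡m (trans (identity (T ∸ suc y) y) (cong (λ t → 2 * (2 * t)) (m∸n+n≡m 1+y≤T)))
  where
  identity : ∀ q y → suc (2 * suc (2 * q)) + suc (2 * (2 * y)) ≡ 2 * (2 * (q + suc y))
  identity = solve-∀

4T∸[3+4y] : ∀ T y → suc y ≤ T → 2 * (2 * T) ∸ suc (2 * suc (2 * y)) ≡ suc (2 * (2 * (T ∸ suc y)))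
4T∸[3+4y] T y 1+y≤T =
  m+n≡o⇒o∸n≡m (trans (identity (T ∸ suc y) y) (cong (λ t → 2 * (2 * t)) (m∸n+n≡m 1+y≤T)))
  where
  identity : ∀ q y → suc (2 * (2 * q)) + suc (2 * suc (2 * y)) ≡ 2 * (2 * (q + suc y))
  identity = solve-∀

-- The Stern recurrences

sternF-even : ∀ f m → 2 ≤ m → m % 2 ≡ 0 → sternF (suc f) m ≡ tmul (sternF f (m / 2))
sternF-even f (suc (suc m)) (s≤s (s≤s _)) eq rewrite eq = refl

sternF-odd : ∀ f m → 2 ≤ m → m % 2 ≡ 1 →
             sternF (suc f) m ≡ sternF f (m / 2) ⊕ sternF f (suc (m / 2))
sternF-odd f (suc (suc m)) (s≤s (s≤s _)) eq rewrite eq = refl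

sternF-2[1+x] : ∀ f x → sternF (suc f) (2 * suc x) ≡ tmul (sternF f (suc x))
sternF-2[1+x] f x = begin
  sternF (suc f) (2 * suc x)      ≡⟨ sternF-even f _ (2≤2[1+x] x) (2x%2≡0 (suc x)) ⟩
  tmul (sternF f (2 * suc x / 2)) ≡⟨ cong (tmul ∘ sternF f) (2x/2≡x (suc x)) ⟩
  tmul (sternF f (suc x))         ∎
  where open ≡-Reasoning

sternF-1+2[1+x] : ∀ f x →
  sternF (suc f) (suc (2 * suc x)) ≡ sternF f (suc x) ⊕ sternF f (suc (suc x))
sternF-1+2[1+x] f x = begin
  sternF (suc f) (suc (2 * suc x))
    ≡⟨ sternF-odd f _ (m≤n⇒m≤1+n (2≤2[1+x] x)) ([1+2x]%2≡1 (suc x)) ⟩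
  sternF f (suc (2 * suc x) / 2) ⊕ sternF f (suc (suc (2 * suc x) / 2))
    ≡⟨ cong (λ h → sternF f h ⊕ sternF f (suc h)) ([1+2x]/2≡x (suc x)) ⟩
  sternF f (suc x) ⊕ sternF f (suc (suc x)) ∎
  where open ≡-Reasoning

sternF-fuel : ∀ {f g} n → n < f → n < g → sternF f n ≡ sternF g n
sternF-fuel {suc f} {suc g} n (s≤s n≤f) (s≤s n≤g) with evenOrOdd n
... | even zero    = refl
... | odd zero     = refl
... | even (suc x) = begin
  sternF (suc f) (2 * suc x) ≡⟨ sternF-2[1+x] f x ⟩
  tmul (sternF f (suc x))    ≡⟨ cong tmul (sternF-fuel (suc x) (half< n≤f) (half< n≤g)) ⟩
  tmul (sternF g (suc x))    ≡⟨ sternF-2[1+x] g x ⟨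
  sternF (suc g) (2 * suc x) ∎
  where
  open ≡-Reasoning
  half< : ∀ {h} → 2 * suc x ≤ h → suc x < h
  half< = <-≤-trans (1+x<2[1+x] x)
... | odd (suc x)  = begin
  sternF (suc f) (suc (2 * suc x))           ≡⟨ sternF-1+2[1+x] f x ⟩
  sternF f (suc x) ⊕ sternF f (suc (suc x))
    ≡⟨ cong₂ _⊕_ (sternF-fuel (suc x) (half< n≤f) (half< n≤g))
                 (sternF-fuel (suc (suc x)) (half+1< n≤f) (half+1< n≤g)) ⟩
  sternF g (suc x) ⊕ sternF g (suc (suc x))  ≡⟨ sternF-1+2[1+x] g x ⟨
  sternF (suc g) (suc (2 * suc x))           ∎
  where
  open ≡-Reasoning
  half+1< : ∀ {h} → suc (2 * suc x) ≤ h → suc (suc x) < h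
  half+1< = <-≤-trans (s≤s (1+x<2[1+x] x))
  half< : ∀ {h} → suc (2 * suc x) ≤ h → suc x < h
  half< h = <-trans (n<1+n (suc x)) (half+1< h)

B-2[1+x] : ∀ x → B (2 * suc x) ≡ tmul (B (suc x))
B-2[1+x] x = trans (sternF-2[1+x] (2 * suc x) x)
                   (cong tmul (sternF-fuel (suc x) (1+x<2[1+x] x) ≤-refl))

B-1+2x : ∀ x → B (suc (2 * x)) ≡ B x ⊕ B (suc x)
B-1+2x zero    = refl
B-1+2x (suc x) = trans (sternF-1+2[1+x] (suc (2 * suc x)) x)
  (cong₂ _⊕_ (sternF-fuel (suc x) (m<n⇒m<1+n (1+x<2[1+x] x)) ≤-refl)
             (sternF-fuel (suc (suc x)) (s≤s (1+x<2[1+x] x)) ≤-refl))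

B-leadingPositive : ∀ n → 0 < n → LeadingPositive (B n)
B-leadingPositive = <-rec _ step
  where
  step : ∀ n → (∀ {m} → m < n → 0 < m → LeadingPositive (B m)) → 0 < n → LeadingPositive (B n)
  step n rec 0<n with evenOrOdd n
  step .0 rec () | even zero
  ... | even (suc x) = subst LeadingPositive (sym (B-2[1+x] x))
    (tmul-leadingPositive (B (suc x)) (rec (1+x<2[1+x] x) (s≤s z≤n)))
  ... | odd zero     = 0 , refl
  ... | odd (suc x)  = subst LeadingPositive (sym (B-1+2x (suc x)))
    (⊕-leadingPositive (B (suc x)) (B (suc (suc x)))
      (rec (m<n⇒m<1+n (1+x<2[1+x] x)) (s≤s z≤n)) (rec (s≤s (1+x<2[1+x] x)) (s≤s z≤n)))

B-2n : ∀ n → B (2 * n) ≡ t· B n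
B-2n zero    = refl
B-2n (suc x) = trans (B-2[1+x] x) (tmul≡t· _ (B-leadingPositive (suc x) (s≤s z≤n)))

B[2^n+l] : ∀ n l → l ≤ 2 ^ n → B (2 ^ n + l) ≡ B (2 ^ n ∸ l) ⊕ t· B l
B[2^n+l] zero    0 _ = refl
B[2^n+l] zero    1 _ = refl
B[2^n+l] zero    (suc (suc _)) (s≤s ())
B[2^n+l] (suc n) l l≤2P with evenOrOdd l
... | even m = begin
  B (2 * P + 2 * m)           ≡⟨ cong B (*-distribˡ-+ 2 P m) ⟨
  B (2 * (P + m))             ≡⟨ B-2n (P + m) ⟩
  t· B (P + m)                ≡⟨ cong t·_ (B[2^n+l] n m m≤P) ⟩
  t· (B (P ∸ m) ⊕ t· B m)     ≡⟨ t·-distrib-⊕ (B (P ∸ m)) (t· B m) ⟩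
  t· B (P ∸ m) ⊕ t· t· B m    ≡⟨ cong₂ (λ u v → u ⊕ t· v) (B-2n (P ∸ m)) (B-2n m) ⟨
  B (2 * (P ∸ m)) ⊕ t· B (2 * m) ≡⟨ cong (λ u → B u ⊕ t· B (2 * m)) (*-distribˡ-∸ 2 P m) ⟩
  B (2 * P ∸ 2 * m) ⊕ t· B (2 * m) ∎
  where
  open ≡-Reasoning
  P = 2 ^ n
  m≤P : m ≤ P
  m≤P = *-cancelˡ-≤ 2 l≤2P
... | odd m = begin
  B (2 * P + suc (2 * m))        ≡⟨ cong B (identity P m) ⟩
  B (suc (2 * (P + m)))          ≡⟨ B-1+2x (P + m) ⟩
  B (P + m) ⊕ B (suc (P + m))    ≡⟨ cong (λ h → B (P + m) ⊕ B h) (+-suc P m) ⟨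
  B (P + m) ⊕ B (P + suc m)
    ≡⟨ cong₂ _⊕_ (B[2^n+l] n m (<⇒≤ 1+m≤P)) (B[2^n+l] n (suc m) 1+m≤P) ⟩
  (B (P ∸ m) ⊕ t· B m) ⊕ (B (P ∸ suc m) ⊕ t· B (suc m))
    ≡⟨ ⊕-interchange (B (P ∸ m)) (t· B m) (B (P ∸ suc m)) (t· B (suc m)) ⟩
  (B (P ∸ m) ⊕ B (P ∸ suc m)) ⊕ (t· B m ⊕ t· B (suc m))
    ≡⟨ cong₂ _⊕_ (⊕-comm (B (P ∸ suc m)) (B (P ∸ m))) (t·-distrib-⊕ (B m) (B (suc m))) ⟨
  (B (P ∸ suc m) ⊕ B (P ∸ m)) ⊕ t· (B m ⊕ B (suc m))
    ≡⟨ cong (λ h → (B (P ∸ suc m) ⊕ B h) ⊕ t· (B m ⊕ B (suc m))) (1+[m∸[1+n]]≡m∸n 1+m≤P) ⟨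
  (B (P ∸ suc m) ⊕ B (suc (P ∸ suc m))) ⊕ t· (B m ⊕ B (suc m))
    ≡⟨ cong₂ (λ u v → u ⊕ t· v) (B-1+2x (P ∸ suc m)) (B-1+2x m) ⟨
  B (suc (2 * (P ∸ suc m))) ⊕ t· B (suc (2 * m))
    ≡⟨ cong (λ h → B h ⊕ t· B (suc (2 * m))) (2P∸[1+2m] P m 1+m≤P) ⟨
  B (2 * P ∸ suc (2 * m)) ⊕ t· B (suc (2 * m)) ∎
  where
  open ≡-Reasoning
  P = 2 ^ n
  1+m≤P : suc m ≤ P
  1+m≤P = *-cancelˡ-< 2 m P l≤2P
  identity : ∀ P m → 2 * P + suc (2 * m) ≡ suc (2 * (P + m))
  identity = solve-∀

B[2^[1+n]+l] : ∀ n l → l ≤ 2 ^ n → B (2 ^ suc n + l) ≡ (B l ⊕ t· B (2 ^ n ∸ l)) ⊕ t· B l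
B[2^[1+n]+l] n l l≤P = begin
  B (2 * P + l)
    ≡⟨ B[2^n+l] (suc n) l (≤-trans l≤P (m≤m+n P _)) ⟩
  B (2 * P ∸ l) ⊕ t· B l
    ≡⟨ cong (λ h → B h ⊕ t· B l) 2P∸l≡P+[P∸l] ⟩
  B (P + (P ∸ l)) ⊕ t· B l
    ≡⟨ cong (_⊕ t· B l) (B[2^n+l] n (P ∸ l) (m∸n≤m P l)) ⟩
  (B (P ∸ (P ∸ l)) ⊕ t· B (P ∸ l)) ⊕ t· B l
    ≡⟨ cong (λ h → (B h ⊕ t· B (P ∸ l)) ⊕ t· B l) (m∸[m∸n]≡n l≤P) ⟩
  (B l ⊕ t· B (P ∸ l)) ⊕ t· B l ∎
  where
  open ≡-Reasoning
  P = 2 ^ n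
  2P∸l≡P+[P∸l] : 2 * P ∸ l ≡ P + (P ∸ l)
  2P∸l≡P+[P∸l] = trans (cong (λ x → P + x ∸ l) (+-identityʳ P)) (+-∸-assoc P l≤P)

-- Coefficient counts

-- Equals deg (B n) + 1 for n ≥ 1, since B n then has a positive leading coefficient.
lenB : ℕ → ℕ
lenB n = length (B n)

lenB-2[1+x] : ∀ x → lenB (2 * suc x) ≡ suc (lenB (suc x))
lenB-2[1+x] x = cong length (B-2[1+x] x)

lenB-2n : ∀ n → 0 < n → lenB (2 * n) ≡ suc (lenB n)
lenB-2n (suc x) _ = lenB-2[1+x] x

lenB-2+2x : ∀ x → lenB (suc (suc (2 * x))) ≡ suc (lenB (suc x))
lenB-2+2x x = trans (cong lenB (sym (*-suc 2 x))) (lenB-2[1+x] x)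

lenB-1+2x : ∀ x → lenB (suc (2 * x)) ≡ lenB x ⊔ lenB (suc x)
lenB-1+2x x = trans (cong length (B-1+2x x)) (length-⊕ (B x) (B (suc x)))

lenB-neighbours : ∀ n → lenB (suc n) ≤ suc (lenB n) × lenB n ≤ suc (lenB (suc n))
lenB-neighbours = <-rec _ step
  where
  step : ∀ n → (∀ {m} → m < n → lenB (suc m) ≤ suc (lenB m) × lenB m ≤ suc (lenB (suc m))) →
         lenB (suc n) ≤ suc (lenB n) × lenB n ≤ suc (lenB (suc n))
  step n rec with evenOrOdd n
  ... | even zero    = s≤s z≤n , z≤n
  ... | even (suc y) rewrite lenB-1+2x (suc y) | lenB-2[1+x] y =
    ⊔-lub (m≤n⇒m≤1+n (n≤1+n _)) (m≤n⇒m≤1+n (proj₁ (rec (1+x<2[1+x] y)))) , s≤s (m≤m⊔n _ _)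
  ... | odd x        rewrite lenB-1+2x x | lenB-2+2x x =
    s≤s (m≤n⊔m _ _) , ⊔-lub (m≤n⇒m≤1+n (proj₂ (rec (s≤s (m≤m+n x _))))) (m≤n⇒m≤1+n (n≤1+n _))

lenB-1+4k : ∀ k → 0 < k → lenB (suc (2 * (2 * k))) ≡ suc (lenB k)
lenB-1+4k (suc y) _ = begin
  lenB (suc (2 * (2 * suc y)))
    ≡⟨ lenB-1+2x (2 * suc y) ⟩
  lenB (2 * suc y) ⊔ lenB (suc (2 * suc y))
    ≡⟨ cong₂ _⊔_ (lenB-2[1+x] y) (lenB-1+2x (suc y)) ⟩
  suc (lenB (suc y)) ⊔ (lenB (suc y) ⊔ lenB (suc (suc y)))
    ≡⟨ m≥n⇒m⊔n≡m (⊔-lub (n≤1+n _) (proj₁ (lenB-neighbours (suc y)))) ⟩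
  suc (lenB (suc y)) ∎
  where open ≡-Reasoning

lenB-3+4k : ∀ k → lenB (suc (2 * suc (2 * k))) ≡ suc (lenB (suc k))
lenB-3+4k k = begin
  lenB (suc (2 * suc (2 * k)))
    ≡⟨ lenB-1+2x (suc (2 * k)) ⟩
  lenB (suc (2 * k)) ⊔ lenB (suc (suc (2 * k)))
    ≡⟨ cong₂ _⊔_ (lenB-1+2x k) (lenB-2+2x k) ⟩
  (lenB k ⊔ lenB (suc k)) ⊔ suc (lenB (suc k))
    ≡⟨ m≤n⇒m⊔n≡n (⊔-lub (proj₂ (lenB-neighbours k)) (n≤1+n _)) ⟩
  suc (lenB (suc k)) ∎
  where open ≡-Reasoning

-- The intervals I_k

a-bounds : ∀ i → 2 ^ suc i < 3 * a (suc i) × 3 * a (suc i) ≤ 2 + 2 ^ suc i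
a-bounds 0             = ≤-refl , s≤s (s≤s (s≤s z≤n))
a-bounds 1             = s≤s (s≤s (s≤s (s≤s (s≤s z≤n)))) , ≤-refl
a-bounds (suc (suc i)) = step (2 ^ suc i) (a (suc i)) (a-bounds i)
  where
  step : ∀ P A → P < 3 * A × 3 * A ≤ 2 + P →
         2 * (2 * P) < 3 * (P + A) × 3 * (P + A) ≤ 2 + 2 * (2 * P)
  step P A (lo , hi) = subst₂ _<_ (4P P) (3[P+A] P A) (+-monoʳ-< (3 * P) lo)
                     , subst₂ _≤_ (3[P+A] P A) (2+4P P) (+-monoʳ-≤ (3 * P) hi)
    where
    4P : ∀ P → 3 * P + P ≡ 2 * (2 * P)
    4P = solve-∀
    3[P+A] : ∀ P A → 3 * P + 3 * A ≡ 3 * (P + A)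
    3[P+A] = solve-∀
    2+4P : ∀ P → 3 * P + (2 + P) ≡ 2 + 2 * (2 * P)
    2+4P = solve-∀

a-positive : ∀ i → 0 < a (suc i)
a-positive i with a (suc i) | proj₁ (a-bounds i)
... | suc _ | _ = s≤s z≤n

a[1+i]≤2^i : ∀ i → a (suc i) ≤ 2 ^ i
a[1+i]≤2^i zero    = ≤-refl
a[1+i]≤2^i (suc i) = *-cancelˡ-≤ 3 (begin
  3 * a (suc (suc i))       ≤⟨ proj₂ (a-bounds (suc i)) ⟩
  2 + 2 * P                 ≤⟨ +-monoˡ-≤ (2 * P) (*-monoʳ-≤ 2 (m^n>0 2 i)) ⟩
  P + 2 * P                 ≡⟨ identity P ⟩
  3 * P                     ∎)
  where
  open ≤-Reasoning
  P = 2 ^ suc i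
  identity : ∀ P → P + 2 * P ≡ 3 * P
  identity = solve-∀

a[2+i]≤2*a[1+i] : ∀ i → a (suc (suc i)) ≤ 2 * a (suc i)
a[2+i]≤2*a[1+i] i = *-cancelˡ-≤ 3 (begin
  3 * a (suc (suc i))   ≤⟨ proj₂ (a-bounds (suc i)) ⟩
  2 + 2 * P             ≡⟨ *-suc 2 P ⟨
  2 * suc P             ≤⟨ *-monoʳ-≤ 2 (proj₁ (a-bounds i)) ⟩
  2 * (3 * A)           ≡⟨ identity A ⟩
  3 * (2 * A)           ∎)
  where
  open ≤-Reasoning
  P = 2 ^ suc i
  A = a (suc i)
  identity : ∀ A → 2 * (3 * A) ≡ 3 * (2 * A)
  identity = solve-∀

2*a[1+i]≤a[2+i]+1 : ∀ i → 2 * a (suc i) ≤ a (suc (suc i)) + 1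
2*a[1+i]≤a[2+i]+1 i = *-cancelˡ-≤ 3 (begin
  3 * (2 * A)           ≡⟨ identity₁ A ⟩
  2 * (3 * A)           ≤⟨ *-monoʳ-≤ 2 (proj₂ (a-bounds i)) ⟩
  2 * (2 + P)           ≡⟨ identity₂ P ⟩
  suc (2 * P) + 3       ≤⟨ +-monoˡ-≤ 3 (proj₁ (a-bounds (suc i))) ⟩
  3 * A′ + 3            ≡⟨ identity₃ A′ ⟩
  3 * (A′ + 1)          ∎)
  where
  open ≤-Reasoning
  P = 2 ^ suc i
  A = a (suc i)
  A′ = a (suc (suc i))
  identity₁ : ∀ A → 3 * (2 * A) ≡ 2 * (3 * A)
  identity₁ = solve-∀
  identity₂ : ∀ P → 2 * (2 + P) ≡ suc (2 * P) + 3
  identity₂ = solve-∀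
  identity₃ : ∀ A → 3 * A + 3 ≡ 3 * (A + 1)
  identity₃ = solve-∀

4*a[1+i]≤a[3+i]+2 : ∀ i → 4 * a (suc i) ≤ a (suc (suc (suc i))) + 2
4*a[1+i]≤a[3+i]+2 i = begin
  4 * A           ≡⟨ identity₁ A ⟩
  3 * A + A       ≤⟨ +-monoˡ-≤ A (proj₂ (a-bounds i)) ⟩
  (2 + P) + A     ≡⟨ identity₂ P A ⟩
  (P + A) + 2     ∎
  where
  open ≤-Reasoning
  P = 2 ^ suc i
  A = a (suc i)
  identity₁ : ∀ A → 4 * A ≡ 3 * A + A
  identity₁ = solve-∀
  identity₂ : ∀ P A → (2 + P) + A ≡ (P + A) + 2
  identity₂ = solve-∀

a[3+i]+1≤4*a[1+i] : ∀ i → a (suc (suc (suc i))) + 1 ≤ 4 * a (suc i)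
a[3+i]+1≤4*a[1+i] i = begin
  (P + A) + 1     ≡⟨ identity₁ P A ⟩
  suc P + A       ≤⟨ +-monoˡ-≤ A (proj₁ (a-bounds i)) ⟩
  3 * A + A       ≡⟨ identity₂ A ⟩
  4 * A           ∎
  where
  open ≤-Reasoning
  P = 2 ^ suc i
  A = a (suc i)
  identity₁ : ∀ P A → (P + A) + 1 ≡ suc P + A
  identity₁ = solve-∀
  identity₂ : ∀ A → 3 * A + A ≡ 4 * A
  identity₂ = solve-∀

-- I_k = [a_k, a_(k+1)), the integers of NAF-bitlength k.
infix 4 _∈I_
_∈I_ : ℕ → ℕ → Set
l ∈I k = a k ≤ l × l < a (suc k)

∈I-positive : ∀ j {l} → l ∈I suc j → 0 < l
∈I-positive j (lo , _) = <-≤-trans (a-positive j) lo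

∈I-<2^ : ∀ j {l} → l ∈I suc j → l < 2 ^ suc j
∈I-<2^ j (_ , hi) = <-≤-trans hi (a[1+i]≤2^i (suc j))

∈I-half : ∀ k x → 2 * x ∈I suc (suc k) → x ∈I suc k
∈I-half k x (lo , hi) =
  c*y≤c*x+r⇒y≤x 2 ≤-refl (≤-trans (2*a[1+i]≤a[2+i]+1 k) (+-monoˡ-≤ 1 lo)) ,
  *-cancelˡ-< 2 x _ (<-≤-trans hi (a[2+i]≤2*a[1+i] (suc k)))

∈I-1+4k : ∀ k y → suc (2 * (2 * y)) ∈I suc (suc (suc k)) → y ∈I suc k
∈I-1+4k k y (lo , hi) = c*y≤c*x+r⇒y≤x 4 (s≤s ≤-refl) (begin
    4 * a (suc k)              ≤⟨ 4*a[1+i]≤a[3+i]+2 k ⟩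
    a (suc (suc (suc k))) + 2  ≤⟨ +-monoˡ-≤ 2 lo ⟩
    suc (2 * (2 * y)) + 2      ≡⟨ identity₁ y ⟩
    4 * y + 3                  ∎)
  , *-cancelˡ-< 4 y _ (begin-strict
    4 * y                            ≡⟨ identity₂ y ⟩
    2 * (2 * y)                      <⟨ n<1+n _ ⟩
    suc (2 * (2 * y))                <⟨ hi ⟩
    a (suc (suc (suc (suc k))))      ≤⟨ m≤m+n _ 1 ⟩
    a (suc (suc (suc (suc k)))) + 1  ≤⟨ a[3+i]+1≤4*a[1+i] (suc k) ⟩
    4 * a (suc (suc k))              ∎)
  where
  open ≤-Reasoning
  identity₁ : ∀ y → suc (2 * (2 * y)) + 2 ≡ 4 * y + 3
  identity₁ = solve-∀
  identity₂ : ∀ y → 4 * y ≡ 2 * (2 * y)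
  identity₂ = solve-∀

∈I-3+4k : ∀ k y → suc (2 * suc (2 * y)) ∈I suc (suc (suc k)) → suc y ∈I suc k
∈I-3+4k k y (lo , hi) = c*y≤c*x+r⇒y≤x 4 (s≤s (s≤s z≤n)) (begin
    4 * a (suc k)              ≤⟨ 4*a[1+i]≤a[3+i]+2 k ⟩
    a (suc (suc (suc k))) + 2  ≤⟨ +-monoˡ-≤ 2 lo ⟩
    suc (2 * suc (2 * y)) + 2  ≡⟨ identity₁ y ⟩
    4 * suc y + 1              ∎)
  , *-cancelˡ-< 4 (suc y) _ (begin-strict
    4 * suc y                        ≡⟨ identity₂ y ⟩
    suc (2 * suc (2 * y)) + 1        <⟨ +-monoˡ-< 1 hi ⟩
    a (suc (suc (suc (suc k)))) + 1  ≤⟨ a[3+i]+1≤4*a[1+i] (suc k) ⟩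
    4 * a (suc (suc k))              ∎)
  where
  open ≤-Reasoning
  identity₁ : ∀ y → suc (2 * suc (2 * y)) + 2 ≡ 4 * suc y + 1
  identity₁ = solve-∀
  identity₂ : ∀ y → 4 * suc y ≡ suc (2 * suc (2 * y)) + 1
  identity₂ = solve-∀

-- Symmetry of coefficient counts on I_k

LenBSymmetric : ℕ → Set
LenBSymmetric j = ∀ l → l ∈I suc j → lenB l ≡ lenB (2 ^ suc j ∸ l)

lenB-symmetric-2x : ∀ i → LenBSymmetric (suc i) →
  ∀ x → 2 * x ∈I suc (suc (suc i)) → lenB (2 * x) ≡ lenB (2 ^ suc (suc (suc i)) ∸ 2 * x)
lenB-symmetric-2x i sym₁ x 2x∈ = begin
  lenB (2 * x)           ≡⟨ lenB-2n x (∈I-positive (suc i) x∈) ⟩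
  suc (lenB x)           ≡⟨ cong suc (sym₁ x x∈) ⟩
  suc (lenB (P ∸ x))     ≡⟨ lenB-2n (P ∸ x) (m<n⇒0<n∸m (∈I-<2^ (suc i) x∈)) ⟨
  lenB (2 * (P ∸ x))     ≡⟨ cong lenB (*-distribˡ-∸ 2 P x) ⟩
  lenB (2 * P ∸ 2 * x)   ∎
  where
  open ≡-Reasoning
  P = 2 ^ suc (suc i)
  x∈ = ∈I-half (suc i) x 2x∈

lenB-symmetric-1+4k : ∀ i → LenBSymmetric i →
  ∀ y → suc (2 * (2 * y)) ∈I suc (suc (suc i)) →
  lenB (suc (2 * (2 * y))) ≡ lenB (2 ^ suc (suc (suc i)) ∸ suc (2 * (2 * y)))
lenB-symmetric-1+4k i sym₀ y l∈ = begin
  lenB (suc (2 * (2 * y)))               ≡⟨ lenB-1+4k y (∈I-positive i y∈) ⟩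
  suc (lenB y)                           ≡⟨ cong suc (sym₀ y y∈) ⟩
  suc (lenB (T ∸ y))                     ≡⟨ cong (suc ∘ lenB) (1+[m∸[1+n]]≡m∸n 1+y≤T) ⟨
  suc (lenB (suc (T ∸ suc y)))           ≡⟨ lenB-3+4k (T ∸ suc y) ⟨
  lenB (suc (2 * suc (2 * (T ∸ suc y)))) ≡⟨ cong lenB (4T∸[1+4y] T y 1+y≤T) ⟨
  lenB (2 * (2 * T) ∸ suc (2 * (2 * y))) ∎
  where
  open ≡-Reasoning
  T = 2 ^ suc i
  y∈ = ∈I-1+4k i y l∈
  1+y≤T = ∈I-<2^ i y∈

lenB-symmetric-3+4k : ∀ i → LenBSymmetric i →
  ∀ y → suc (2 * suc (2 * y)) ∈I suc (suc (suc i)) →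
  lenB (suc (2 * suc (2 * y))) ≡ lenB (2 ^ suc (suc (suc i)) ∸ suc (2 * suc (2 * y)))
lenB-symmetric-3+4k i sym₀ y l∈ = begin
  lenB (suc (2 * suc (2 * y)))               ≡⟨ lenB-3+4k y ⟩
  suc (lenB (suc y))                         ≡⟨ cong suc (sym₀ (suc y) 1+y∈) ⟩
  suc (lenB (T ∸ suc y))                     ≡⟨ lenB-1+4k (T ∸ suc y) (m<n⇒0<n∸m (∈I-<2^ i 1+y∈)) ⟨
  lenB (suc (2 * (2 * (T ∸ suc y))))         ≡⟨ cong lenB (4T∸[3+4y] T y (<⇒≤ (∈I-<2^ i 1+y∈))) ⟨
  lenB (2 * (2 * T) ∸ suc (2 * suc (2 * y))) ∎
  where
  open ≡-Reasoning
  T = 2 ^ suc i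
  1+y∈ = ∈I-3+4k i y l∈

lenB-symmetric₀ : LenBSymmetric 0
lenB-symmetric₀ 1             _ = refl
lenB-symmetric₀ 0             (() , _)
lenB-symmetric₀ (suc (suc _)) (_ , s≤s (s≤s ()))

lenB-symmetric₁ : LenBSymmetric 1
lenB-symmetric₁ 2                   _ = refl
lenB-symmetric₁ 0                   (() , _)
lenB-symmetric₁ 1                   (s≤s () , _)
lenB-symmetric₁ (suc (suc (suc _))) (_ , s≤s (s≤s (s≤s ())))

lenB-symmetric-step : ∀ i → LenBSymmetric (suc i) → LenBSymmetric i → LenBSymmetric (suc (suc i))
lenB-symmetric-step i sym₁ sym₀ l with residue4 l
... | even x = lenB-symmetric-2x i sym₁ x
... | 1+4k y = lenB-symmetric-1+4k i sym₀ y
... | 3+4k y = lenB-symmetric-3+4k i sym₀ y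

lenB-symmetric : ∀ j → LenBSymmetric j
lenB-symmetric 0             = lenB-symmetric₀
lenB-symmetric 1             = lenB-symmetric₁
lenB-symmetric (suc (suc i)) = lenB-symmetric-step i (lenB-symmetric (suc i)) (lenB-symmetric i)

mainTheorem11 : (k v : ℕ) → 3 ≤ k → v < cardI (k ∸ 2) →
    (deg (B (c k + v)) ≡ deg (B (2 ^ (k ∸ 2) ∸ (a (k ∸ 2) + v))) + 1)
    × (lc (B (c k + v)) ≡ lc (B (2 ^ (k ∸ 2) ∸ (a (k ∸ 2) + v))) +ℤ lc (B (a (k ∸ 2) + v)))
mainTheorem11 1 _ (s≤s ()) _
mainTheorem11 2 _ (s≤s (s≤s ())) _
mainTheorem11 (suc (suc (suc i))) v _ v<|I| =
  subst (λ r → (deg r ≡ deg (B m) + 1) × (lc r ≡ lc (B m) +ℤ lc (B l))) (sym B[c+v])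
    (leading-terms (B l) (B m) (B-leadingPositive l (∈I-positive i l∈I))
                   (B-leadingPositive m (m<n⇒0<n∸m l<P)) (lenB-symmetric i l l∈I))
  where
  l = a (suc i) + v
  m = 2 ^ suc i ∸ l
  l∈I : l ∈I suc i
  l∈I = m≤m+n (a (suc i)) v , v<n∸m⇒m+v<n (a (suc i)) v<|I|
  l<P : l < 2 ^ suc i
  l<P = ∈I-<2^ i l∈I
  B[c+v] : B (c (suc (suc (suc i))) + v) ≡ (B l ⊕ t· B m) ⊕ t· B l
  B[c+v] = trans (cong B (+-assoc (2 ^ suc (suc i)) (a (suc i)) v)) (B[2^[1+n]+l] (suc i) l (<⇒≤ l<P))
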